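{- Let $X_0,X_n$ be Gamma-LD graphs with $X_0\gg X_n$. Then (i) any occurrence of $X_0$ lying in an even region of a graph can be transformed (by rule applications) into $X_n$; and (ii) any occurrence of $X_n$ lying in an odd region of a graph can be transformed into $X_0$.
   Context: Gamma-LD graphs: built from the empty graph $\lambda$ and atoms (classical atoms $a,b,\dots$ and alternate atoms $\underline a,\underline b,\dots$) by juxtaposition $XY$ (commutative, associative), classical cut $(X)$ and alternate cut $[X]$. Alternate graphs $\underline X$: alternate atoms or graphs $[Y]$. An occurrence lies in an even (odd) region if enclosed by an even (odd) number of cuts of either kind, and in a classical region if enclosed by no alternate cut. A rule $X\Rightarrow Y$ (with a region condition) allows replacing an occurrence of $X$ satisfying the condition by $Y$; $\Leftrightarrow$ means both directions anywhere. Rules: R$\lambda$: $\lambda$ valid; $XY$ in even region $\Rightarrow X$ or $Y$; $X$ in odd region $\Rightarrow XY$ or $YX$; $X\Leftrightarrow((X))$; $[X]$ in even region $\Rightarrow(X)$ and $(X)$ in odd region $\Rightarrow[X]$; if $X$ is valid, $X\Leftrightarrow[(X)]$; $\underline X$ in even region $\Rightarrow[(\underline X)]$ and $[(\underline X)]$ in odd region $\Rightarrow\underline X$; $X\Rightarrow XX$; $XX\Rightarrow X$; $X\,G_n(Y)\Leftrightarrow X\,G_n(XY)$ for $X,Y$ in classical regions, where $G_0(Y)=Y_0Y$, $G_{k+1}(Y)=Y_{k+1}(G_k(Y))$; $\underline X\,H_n(Y)\Leftrightarrow\underline X\,H_n(\underline XY)$ where $H_0(Y)=Y_0Y$, $H_{k+1}(Y)=Y_{k+1}\{H_k(Y)\}$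 with each $\{\cdot\}$ a classical or alternate cut. $X\gg Z$ means $X$ (as a graph on the sheet, region of depth $0$) is transformed into $Z$ by finitely many rule applications; $X$ is valid if $\lambda\gg X$. -}

module Defs where

open import Data.Nat using (ℕ; zero; suc)
open import Data.Bool using (Bool)
open import Data.List using (List; []; _∷_; _++_)
open import Data.Product using (_×_)
open import Relation.Binary.Construct.Closure.ReflexiveTransitive using (Star)
open import Data.List.Relation.Binary.Permutation.Propositional using (_↭_)

-- A graph is a finite juxtaposition (multiset) of items; it is
-- represented as a list of items, commutativity/associativity of
-- juxtaposition being provided by the permutation step `perm` below.
-- The empty graph λ is [].

mutual
  data Item : Set where
    atom  : ℕ → Item
    aatom : ℕ → Item
    ccut  : Graph → Item
    acut  : Graph → Item

  Graph : Set
  Graph = List Item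

emptyG : Graph
emptyG = []

data IsAlt : Item → Set where
  alt-atom : ∀ n → IsAlt (aatom n)
  alt-cut  : ∀ Y → IsAlt (acut Y)

data Ctx : Set where
  here : Graph → Ctx
  inC  : Ctx → Graph → Ctx
  inA  : Ctx → Graph → Ctx

plug : Ctx → Graph → Graph
plug (here R)  X = X ++ R
plug (inC C R) X = ccut (plug C X) ∷ R
plug (inA C R) X = acut (plug C X) ∷ R

depth : Ctx → ℕ
depth (here _)  = 0
depth (inC C _) = suc (depth C)
depth (inA C _) = suc (depth C)

data Classical : Ctx → Set where
  cl-here : ∀ R → Classical (here R)
  cl-inC  : ∀ {C} R → Classical C → Classical (inC C R)

mutual
  data Even : ℕ → Set where
    ev-zero : Even zero
    ev-suc  : ∀ {n} → Odd n → Even (suc n)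

  data Odd : ℕ → Set where
    od-suc : ∀ {n} → Even n → Odd (suc n)

data NestG : Set where
  baseG  : Graph → NestG
  layerG : Graph → NestG → NestG

fillG : NestG → Graph → Graph
fillG (baseG Y₀)     Y = Y₀ ++ Y
fillG (layerG Yk N)  Y = Yk ++ (ccut (fillG N Y) ∷ [])

data CutKind : Set where
  classical alternate : CutKind

cutOf : CutKind → Graph → Item
cutOf classical X = ccut X
cutOf alternate X = acut X

data NestH : Set where
  baseH  : Graph → NestH
  layerH : Graph → CutKind → NestH → NestH

fillH : NestH → Graph → Graph
fillH (baseH Y₀)       Y = Y₀ ++ Y
fillH (layerH Yk k N)  Y = Yk ++ (cutOf k (fillH N Y) ∷ [])

-- One rule application, and validity (λ ≫ X), defined simultaneously
-- since the rule X ⇔ [(X)] requires X to be valid.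

[_] : Item → Graph
[ x ] = x ∷ []

mutual
  infix 4 _⟶_
  data _⟶_ : Graph → Graph → Set where
    perm       : ∀ C {X X′} → X ↭ X′ → plug C X ⟶ plug C X′
    eraseˡ     : ∀ C X Y → Even (depth C) → plug C (X ++ Y) ⟶ plug C X
    eraseʳ     : ∀ C X Y → Even (depth C) → plug C (X ++ Y) ⟶ plug C Y
    insertʳ    : ∀ C X Y → Odd (depth C) → plug C X ⟶ plug C (X ++ Y)
    insertˡ    : ∀ C X Y → Odd (depth C) → plug C X ⟶ plug C (Y ++ X)
    dcut-intro : ∀ C X → plug C X ⟶ plug C [ ccut [ ccut X ] ]
    dcut-elim  : ∀ C X → plug C [ ccut [ ccut X ] ] ⟶ plug C X
    alt→cl     : ∀ C X → Even (depth C) → plug C [ acut X ] ⟶ plug C [ ccut X ]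
    cl→alt     : ∀ C X → Odd (depth C) → plug C [ ccut X ] ⟶ plug C [ acut X ]
    valid-intro : ∀ C X → Valid X → plug C X ⟶ plug C [ acut [ ccut X ] ]
    valid-elim  : ∀ C X → Valid X → plug C [ acut [ ccut X ] ] ⟶ plug C X
    altg-intro : ∀ C x → IsAlt x → Even (depth C) →
                 plug C [ x ] ⟶ plug C [ acut [ ccut [ x ] ] ]
    altg-elim  : ∀ C x → IsAlt x → Odd (depth C) →
                 plug C [ acut [ ccut [ x ] ] ] ⟶ plug C [ x ]
    dup        : ∀ C X → plug C X ⟶ plug C (X ++ X)
    contr      : ∀ C X → plug C (X ++ X) ⟶ plug C X
    iter       : ∀ C X N Y → Classical C →
                 plug C (X ++ fillG N Y) ⟶ plug C (X ++ fillG N (X ++ Y))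
    deiter     : ∀ C X N Y → Classical C →
                 plug C (X ++ fillG N (X ++ Y)) ⟶ plug C (X ++ fillG N Y)
    aiter      : ∀ C x N Y → IsAlt x →
                 plug C (x ∷ fillH N Y) ⟶ plug C (x ∷ fillH N (x ∷ Y))
    adeiter    : ∀ C x N Y → IsAlt x →
                 plug C (x ∷ fillH N (x ∷ Y)) ⟶ plug C (x ∷ fillH N Y)

  data Valid (X : Graph) : Set where
    valid : Star _⟶_ [] X → Valid X

infix 4 _≫_
_≫_ : Graph → Graph → Set
_≫_ = Star _⟶_

-- A derivation X₀ ≫ Xₙ gives, by a deduction theorem, the valid implication
-- (X₀ (Xₙ)).  Valid implications are transported through every context:
-- juxtaposition keeps their direction and each cut, classical or alternate,
-- reverses it.  Modus ponens on the sheet turns the transported implication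
-- back into a derivation.  Derivations themselves only transport into
-- classical regions of even depth: iteration requires a classical region, and
-- erasure and insertion depend on parity.

module Submission where

open import Defs
open import Data.Product using (_×_; _,_)
open import Data.Nat using (suc; _+_)
open import Data.List using ([]; _∷_; _++_)
open import Data.List.Properties using (++-assoc; ++-identityʳ)
open import Relation.Binary.PropositionalEquality using (_≡_; refl; sym; cong; subst; subst₂)
open import Relation.Binary.Construct.Closure.ReflexiveTransitive using (ε; _◅_; gmap)
open import Relation.Binary.Construct.Closure.ReflexiveTransitive.Properties using (module StarReasoning)
open import Data.List.Relation.Binary.Permutation.Propositional using (_↭_; ↭-sym; ↭-trans; ↭-reflexive)
open import Data.List.Relation.Binary.Permutation.Propositional.Properties using (++-comm; ++⁺ˡ; shift)

open StarReasoning _⟶_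

_▹_ : Ctx → Graph → Ctx
here R  ▹ R′ = here (R ++ R′)
inC C R ▹ R′ = inC C (R ++ R′)
inA C R ▹ R′ = inA C (R ++ R′)

plug-▹ : ∀ C R X → plug (C ▹ R) X ≡ plug C X ++ R
plug-▹ (here R)  R′ X = sym (++-assoc X R R′)
plug-▹ (inC C R) R′ X = refl
plug-▹ (inA C R) R′ X = refl

depth-▹ : ∀ C R → depth (C ▹ R) ≡ depth C
depth-▹ (here _)  _ = refl
depth-▹ (inC _ _) _ = refl
depth-▹ (inA _ _) _ = refl

Classical-▹ : ∀ {C} → Classical C → ∀ R → Classical (C ▹ R)
Classical-▹ (cl-here R)   R′ = cl-here (R ++ R′)
Classical-▹ (cl-inC R cC) R′ = cl-inC (R ++ R′) cC

_∘ᶜ_ : Ctx → Ctx → Ctx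
here R  ∘ᶜ D = D ▹ R
inC C R ∘ᶜ D = inC (C ∘ᶜ D) R
inA C R ∘ᶜ D = inA (C ∘ᶜ D) R

plug-∘ᶜ : ∀ C D X → plug (C ∘ᶜ D) X ≡ plug C (plug D X)
plug-∘ᶜ (here R)  D X = plug-▹ D R X
plug-∘ᶜ (inC C R) D X = cong (λ G → ccut G ∷ R) (plug-∘ᶜ C D X)
plug-∘ᶜ (inA C R) D X = cong (λ G → acut G ∷ R) (plug-∘ᶜ C D X)

depth-∘ᶜ : ∀ C D → depth (C ∘ᶜ D) ≡ depth C + depth D
depth-∘ᶜ (here R)  D = depth-▹ D R
depth-∘ᶜ (inC C _) D = cong suc (depth-∘ᶜ C D)
depth-∘ᶜ (inA C _) D = cong suc (depth-∘ᶜ C D)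

Classical-∘ᶜ : ∀ {C D} → Classical C → Classical D → Classical (C ∘ᶜ D)
Classical-∘ᶜ (cl-here R)   cD = Classical-▹ cD R
Classical-∘ᶜ (cl-inC R cC) cD = cl-inC R (Classical-∘ᶜ cC cD)

mutual
  even+even : ∀ {m n} → Even m → Even n → Even (m + n)
  even+even ev-zero    en = en
  even+even (ev-suc om) en = ev-suc (odd+even om en)

  odd+even : ∀ {m n} → Odd m → Even n → Odd (m + n)
  odd+even (od-suc em) en = od-suc (even+even em en)

mutual
  even+odd : ∀ {m n} → Even m → Odd n → Odd (m + n)
  even+odd ev-zero     on = on
  even+odd (ev-suc om) on = od-suc (odd+odd om on)

  odd+odd : ∀ {m n} → Odd m → Odd n → Even (m + n)
  odd+odd (od-suc em) on = ev-suc (even+odd em on)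

module _ {C : Ctx} (classical-C : Classical C) (even-C : Even (depth C)) where

  private
    nest : ∀ D {X Y} → plug (C ∘ᶜ D) X ⟶ plug (C ∘ᶜ D) Y →
           plug C (plug D X) ⟶ plug C (plug D Y)
    nest D {X} {Y} = subst₂ _⟶_ (plug-∘ᶜ C D X) (plug-∘ᶜ C D Y)

    even-∘ᶜ : ∀ D → Even (depth D) → Even (depth (C ∘ᶜ D))
    even-∘ᶜ D eD = subst Even (sym (depth-∘ᶜ C D)) (even+even even-C eD)

    odd-∘ᶜ : ∀ D → Odd (depth D) → Odd (depth (C ∘ᶜ D))
    odd-∘ᶜ D oD = subst Odd (sym (depth-∘ᶜ C D)) (even+odd even-C oD)

  plug-⟶ : ∀ {X Y} → X ⟶ Y → plug C X ⟶ plug C Y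
  plug-⟶ (perm D p)            = nest D (perm (C ∘ᶜ D) p)
  plug-⟶ (eraseˡ D X Y e)      = nest D (eraseˡ (C ∘ᶜ D) X Y (even-∘ᶜ D e))
  plug-⟶ (eraseʳ D X Y e)      = nest D (eraseʳ (C ∘ᶜ D) X Y (even-∘ᶜ D e))
  plug-⟶ (insertʳ D X Y o)     = nest D (insertʳ (C ∘ᶜ D) X Y (odd-∘ᶜ D o))
  plug-⟶ (insertˡ D X Y o)     = nest D (insertˡ (C ∘ᶜ D) X Y (odd-∘ᶜ D o))
  plug-⟶ (dcut-intro D X)      = nest D (dcut-intro (C ∘ᶜ D) X)
  plug-⟶ (dcut-elim D X)       = nest D (dcut-elim (C ∘ᶜ D) X)
  plug-⟶ (alt→cl D X e)        = nest D (alt→cl (C ∘ᶜ D) X (even-∘ᶜ D e))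
  plug-⟶ (cl→alt D X o)        = nest D (cl→alt (C ∘ᶜ D) X (odd-∘ᶜ D o))
  plug-⟶ (valid-intro D X v)   = nest D (valid-intro (C ∘ᶜ D) X v)
  plug-⟶ (valid-elim D X v)    = nest D (valid-elim (C ∘ᶜ D) X v)
  plug-⟶ (altg-intro D x a e)  = nest D (altg-intro (C ∘ᶜ D) x a (even-∘ᶜ D e))
  plug-⟶ (altg-elim D x a o)   = nest D (altg-elim (C ∘ᶜ D) x a (odd-∘ᶜ D o))
  plug-⟶ (dup D X)             = nest D (dup (C ∘ᶜ D) X)
  plug-⟶ (contr D X)           = nest D (contr (C ∘ᶜ D) X)
  plug-⟶ (iter D X N Y c)      = nest D (iter (C ∘ᶜ D) X N Y (Classical-∘ᶜ classical-C c))
  plug-⟶ (deiter D X N Y c)    = nest D (deiter (C ∘ᶜ D) X N Y (Classical-∘ᶜ classical-C c))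
  plug-⟶ (aiter D x N Y a)     = nest D (aiter (C ∘ᶜ D) x N Y a)
  plug-⟶ (adeiter D x N Y a)   = nest D (adeiter (C ∘ᶜ D) x N Y a)

  plug-≫ : ∀ {X Y} → X ≫ Y → plug C X ≫ plug C Y
  plug-≫ = gmap (plug C) plug-⟶

⦅_⦆ : Graph → Graph
⦅ X ⦆ = [ ccut X ]

sheet : Ctx
sheet = here []

insideCut : Ctx
insideCut = inC sheet []

onSheet : ∀ {X Y} → plug sheet X ⟶ plug sheet Y → X ≫ Y
onSheet {X} {Y} s = subst₂ _≫_ (++-identityʳ X) (++-identityʳ Y) (s ◅ ε)

inCut : ∀ {X Y} → plug insideCut X ⟶ plug insideCut Y → ⦅ X ⦆ ≫ ⦅ Y ⦆
inCut {X} {Y} s =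
  subst₂ _≫_ (cong ⦅_⦆ (++-identityʳ X)) (cong ⦅_⦆ (++-identityʳ Y)) (s ◅ ε)

permute : ∀ {X Y} → X ↭ Y → X ≫ Y
permute p = onSheet (perm sheet p)

permuteInCut : ∀ {X Y} → X ↭ Y → ⦅ X ⦆ ≫ ⦅ Y ⦆
permuteInCut p = inCut (perm insideCut p)

inDoubleCut : ∀ R {X Y} → X ≫ Y → ⦅ ccut X ∷ R ⦆ ≫ ⦅ ccut Y ∷ R ⦆
inDoubleCut R {X} {Y} d = subst₂ _≫_ (plug-D X) (plug-D Y)
  (plug-≫ (cl-inC [] (cl-inC R (cl-here []))) (ev-suc (od-suc ev-zero)) d)
  where
  plug-D : ∀ Z → plug (inC (inC sheet R) []) Z ≡ ⦅ ccut Z ∷ R ⦆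
  plug-D Z = cong (λ G → ⦅ ccut G ∷ R ⦆) (++-identityʳ Z)

odd-insideCut : Odd (depth insideCut)
odd-insideCut = od-suc ev-zero

classical-insideCut : Classical insideCut
classical-insideCut = cl-inC [] (cl-here [])

_⊃_ : Graph → Graph → Graph
A ⊃ B = ⦅ A ++ ⦅ B ⦆ ⦆

λ≫_⊃λ : ∀ X → [] ≫ X ⊃ []
λ≫ X ⊃λ = dcut-intro sheet [] ◅ insertʳ (inC (here ⦅ [] ⦆) []) [] X odd-insideCut ◅ ε

-- The inner copy of X sits in a classical region of depth 2, where the
-- derivation X ≫ Y can be replayed.
deduction : ∀ {X Y} → X ≫ Y → Valid (X ⊃ Y)
deduction {X} {Y} d = valid (begin
  []                      ⟶*⟨ λ≫ X ⊃λ ⟩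
  ⦅ X ++ ⦅ [] ⦆ ⦆          ⟶*⟨ inCut (iter insideCut X (layerG [] (baseG [])) [] classical-insideCut) ⟩
  ⦅ X ++ ⦅ X ++ [] ⦆ ⦆     ≡⟨ cong (λ G → ⦅ X ++ ⦅ G ⦆ ⦆) (++-identityʳ X) ⟩
  ⦅ X ++ ⦅ X ⦆ ⦆           ⟶*⟨ permuteInCut (++-comm X ⦅ X ⦆) ⟩
  ⦅ ccut X ∷ X ⦆          ⟶*⟨ inDoubleCut X d ⟩
  ⦅ ccut Y ∷ X ⦆          ⟶*⟨ permuteInCut (++-comm ⦅ Y ⦆ X) ⟩
  X ⊃ Y                   ∎)

modusPonens : ∀ {A B} → Valid (A ⊃ B) → A ≫ B
modusPonens {A} {B} (valid proof) = begin
  A                        ⟶*⟨ plug-≫ (cl-here A) ev-zero proof ⟩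
  ccut (A ++ ⦅ B ⦆) ∷ A    ⟶*⟨ permute (++-comm ⦅ A ++ ⦅ B ⦆ ⦆ A) ⟩
  A ++ ⦅ A ++ ⦅ B ⦆ ⦆      ⟶*⟨ onSheet (deiter sheet A (layerG [] (baseG [])) ⦅ B ⦆ (cl-here [])) ⟩
  A ++ ⦅ ⦅ B ⦆ ⦆           ⟶*⟨ permute (++-comm A ⦅ ⦅ B ⦆ ⦆) ⟩
  ccut ⦅ B ⦆ ∷ A           ⟶⟨ dcut-elim (here A) B ⟩
  B ++ A                   ⟶*⟨ onSheet (eraseˡ sheet B A ev-zero) ⟩
  B                        ∎

⊃-juxtapose : ∀ {A B} R → Valid (A ⊃ B) → Valid ((A ++ R) ⊃ (B ++ R))
⊃-juxtapose {A} {B} R (valid proof) = valid (begin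
  []                              ⟶*⟨ proof ⟩
  ⦅ A ++ ⦅ B ⦆ ⦆                   ⟶*⟨ inCut (insertʳ insideCut (A ++ ⦅ B ⦆) R odd-insideCut) ⟩
  ⦅ (A ++ ⦅ B ⦆) ++ R ⦆            ⟶*⟨ permuteInCut (++-comm (A ++ ⦅ B ⦆) R) ⟩
  ⦅ R ++ (A ++ ⦅ B ⦆) ⦆            ⟶*⟨ inCut (iter insideCut R (layerG A (baseG [])) B classical-insideCut) ⟩
  ⦅ R ++ (A ++ ⦅ R ++ B ⦆) ⦆       ⟶*⟨ permuteInCut (rotate R A (ccut (R ++ B))) ⟩
  ⦅ ccut (R ++ B) ∷ (A ++ R) ⦆    ⟶*⟨ inDoubleCut (A ++ R) (permute (++-comm R B)) ⟩
  ⦅ ccut (B ++ R) ∷ (A ++ R) ⦆    ⟶*⟨ permuteInCut (++-comm ⦅ B ++ R ⦆ (A ++ R)) ⟩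
  (A ++ R) ⊃ (B ++ R)             ∎)
  where
  rotate : ∀ (R A : Graph) x → R ++ (A ++ [ x ]) ↭ x ∷ (A ++ R)
  rotate R A x = ↭-trans (↭-reflexive (sym (++-assoc R A [ x ])))
                 (↭-trans (++-comm (R ++ A) [ x ]) (++⁺ˡ [ x ] (++-comm R A)))

⊃-ccut : ∀ {P Q} R → Valid (Q ⊃ P) → Valid ((ccut P ∷ R) ⊃ (ccut Q ∷ R))
⊃-ccut {P} {Q} R (valid proof) = valid (begin
  []                                     ⟶*⟨ λ≫ ccut P ∷ R ⊃λ ⟩
  ⦅ ccut P ∷ (R ++ ⦅ [] ⦆) ⦆              ⟶*⟨ permuteInCut (++-comm (ccut P ∷ R) ⦅ [] ⦆) ⟩
  ⦅ ccut [] ∷ ccut P ∷ R ⦆               ⟶*⟨ inDoubleCut (ccut P ∷ R) proof ⟩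
  ⦅ ccut (Q ⊃ P) ∷ ccut P ∷ R ⦆          ⟶*⟨ permuteInCut (++-comm ⦅ Q ⊃ P ⦆ (ccut P ∷ R)) ⟩
  ⦅ ccut P ∷ (R ++ ⦅ Q ⊃ P ⦆) ⦆          ⟶*⟨ inCut (deiter insideCut [ ccut P ] (layerG R (layerG [] (baseG Q))) [] classical-insideCut) ⟩
  ⦅ ccut P ∷ (R ++ ⦅ ⦅ Q ++ [] ⦆ ⦆) ⦆     ≡⟨ cong (λ G → ⦅ ccut P ∷ (R ++ ⦅ ⦅ G ⦆ ⦆) ⦆) (++-identityʳ Q) ⟩
  ⦅ ccut P ∷ (R ++ ⦅ ⦅ Q ⦆ ⦆) ⦆           ⟶*⟨ permuteInCut (↭-sym (shift (ccut P) R ⦅ ⦅ Q ⦆ ⦆)) ⟩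
  ⦅ R ++ (ccut P ∷ ⦅ ⦅ Q ⦆ ⦆) ⦆           ⟶*⟨ inCut (iter insideCut R (layerG [ ccut P ] (baseG ⦅ Q ⦆)) [] classical-insideCut) ⟩
  ⦅ R ++ (ccut P ∷ ⦅ ccut Q ∷ (R ++ []) ⦆) ⦆ ≡⟨ cong (λ G → ⦅ R ++ (ccut P ∷ ⦅ ccut Q ∷ G ⦆) ⦆) (++-identityʳ R) ⟩
  ⦅ R ++ (ccut P ∷ ⦅ ccut Q ∷ R ⦆) ⦆      ⟶*⟨ permuteInCut (shift (ccut P) R ⦅ ccut Q ∷ R ⦆) ⟩
  (ccut P ∷ R) ⊃ (ccut Q ∷ R)            ∎)

-- The valid implication Q ⊃ P is wrapped as [(Q ⊃ P)]; turning the cut of P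
-- (at odd depth) into [P] makes it a copy of the alternate graph [P] outside,
-- so the alternate deiteration rule removes it.
⊃-acut : ∀ {P Q} R → Valid (Q ⊃ P) → Valid ((acut P ∷ R) ⊃ (acut Q ∷ R))
⊃-acut {P} {Q} R (valid proof) = valid (begin
  []                                             ⟶*⟨ λ≫ acut P ∷ R ⊃λ ⟩
  ⦅ acut P ∷ (R ++ ⦅ [] ⦆) ⦆                      ⟶*⟨ permuteInCut (++-comm (acut P ∷ R) ⦅ [] ⦆) ⟩
  ⦅ ccut [] ∷ acut P ∷ R ⦆                       ⟶*⟨ inDoubleCut (acut P ∷ R) proof ⟩
  ⦅ ccut (Q ⊃ P) ∷ acut P ∷ R ⦆                  ⟶⟨ valid-intro inner (Q ⊃ P) (valid proof) ⟩
  ⦅ ccut [ acut [ ccut (Q ⊃ P) ] ] ∷ acut P ∷ R ⦆ ⟶⟨ dcut-elim inAlt (Q ++ ⦅ P ⦆) ⟩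
  plug inAlt (Q ++ ⦅ P ⦆)                         ⟶⟨ perm inAlt (++-comm Q ⦅ P ⦆) ⟩
  plug inAlt (ccut P ∷ Q)                         ≡⟨ cong wrap (++-identityʳ (ccut P ∷ Q)) ⟩
  wrap (ccut P ∷ Q)                               ⟶⟨ cl→alt besideQ P (od-suc (ev-suc (od-suc ev-zero))) ⟩
  wrap (acut P ∷ Q)                               ≡⟨ cong wrap (++-identityʳ (acut P ∷ Q)) ⟨
  plug inAlt (acut P ∷ Q)                         ⟶⟨ perm inAlt (++-comm [ acut P ] Q) ⟩
  plug inAlt (Q ++ [ acut P ])                    ≡⟨ cong wrap (++-identityʳ (Q ++ [ acut P ])) ⟩
  wrap (Q ++ [ acut P ])                          ⟶*⟨ permuteInCut (++-comm ⦅ [ acut (Q ++ [ acut P ]) ] ⦆ (acut P ∷ R)) ⟩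
  ⦅ acut P ∷ (R ++ ⦅ [ acut (Q ++ [ acut P ]) ] ⦆) ⦆ ⟶*⟨ inCut (adeiter insideCut (acut P) (layerH R classical (layerH [] alternate (baseH Q))) [] (alt-cut P)) ⟩
  ⦅ acut P ∷ (R ++ ⦅ [ acut (Q ++ []) ] ⦆) ⦆      ≡⟨ cong (λ G → ⦅ acut P ∷ (R ++ ⦅ [ acut G ] ⦆) ⦆) (++-identityʳ Q) ⟩
  ⦅ acut P ∷ (R ++ ⦅ [ acut Q ] ⦆) ⦆              ⟶*⟨ permuteInCut (↭-sym (shift (acut P) R ⦅ [ acut Q ] ⦆)) ⟩
  ⦅ R ++ (acut P ∷ ⦅ [ acut Q ] ⦆) ⦆              ⟶*⟨ inCut (iter insideCut R (layerG [ acut P ] (baseG [ acut Q ])) [] classical-insideCut) ⟩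
  ⦅ R ++ (acut P ∷ ⦅ acut Q ∷ (R ++ []) ⦆) ⦆      ≡⟨ cong (λ G → ⦅ R ++ (acut P ∷ ⦅ acut Q ∷ G ⦆) ⦆) (++-identityʳ R) ⟩
  ⦅ R ++ (acut P ∷ ⦅ acut Q ∷ R ⦆) ⦆              ⟶*⟨ permuteInCut (shift (acut P) R ⦅ acut Q ∷ R ⦆) ⟩
  (acut P ∷ R) ⊃ (acut Q ∷ R)                    ∎)
  where
  inner inAlt besideQ : Ctx
  inner = inC (inC sheet (acut P ∷ R)) []
  inAlt = inC (inC (inA sheet []) (acut P ∷ R)) []
  besideQ = inC (inC (inA (here Q) []) (acut P ∷ R)) []

  wrap : Graph → Graph
  wrap G = ⦅ ccut [ acut G ] ∷ acut P ∷ R ⦆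

mutual
  ⊃-plug-even : ∀ C {A B} → Even (depth C) → Valid (A ⊃ B) → Valid (plug C A ⊃ plug C B)
  ⊃-plug-even (here R)  _          v = ⊃-juxtapose R v
  ⊃-plug-even (inC C R) (ev-suc o) v = ⊃-ccut R (⊃-plug-odd C o v)
  ⊃-plug-even (inA C R) (ev-suc o) v = ⊃-acut R (⊃-plug-odd C o v)

  ⊃-plug-odd : ∀ C {A B} → Odd (depth C) → Valid (A ⊃ B) → Valid (plug C B ⊃ plug C A)
  ⊃-plug-odd (inC C R) (od-suc e) v = ⊃-ccut R (⊃-plug-even C e v)
  ⊃-plug-odd (inA C R) (od-suc e) v = ⊃-acut R (⊃-plug-even C e v)

mainTheorem10 : ∀ (X₀ Xₙ : Graph) → X₀ ≫ Xₙ →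
    ((C : Ctx) → Even (depth C) → plug C X₀ ≫ plug C Xₙ) ×
    ((C : Ctx) → Odd (depth C) → plug C Xₙ ≫ plug C X₀)
mainTheorem10 X₀ Xₙ d =
  (λ C even → modusPonens (⊃-plug-even C even (deduction d))) ,
  (λ C odd  → modusPonens (⊃-plug-odd C odd (deduction d)))
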